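{- Let $G$ be one of the following permutation groups on a set $\mathcal{V}$ of size $v$: $\mathrm{M}_v$ for $v\in\{11,12,22,23,24\}$; $\mathrm{M}_{22}.2$ with $v=22$; $\mathrm{M}_{11}$ with $v=12$; $L_2(11)$ with $v=11$; $A_7$ with $v=15$; $\mathrm{HS}$ with $v=176$; $\mathrm{Co}_3$ with $v=276$. Let $2\le k\le v/2$, let $\Gamma\subseteq\binom{\mathcal{V}}{k}$ with $\delta(\Gamma)\ge 2$ be $G$-strongly incidence transitive, and let $\gamma\in\Gamma$. Let $H$ be a maximal subgroup of $G$ with $G_\gamma\le H$. If $H$ is transitive on $\mathcal{V}$ and $N$ is a normal subgroup of $H$ which is intransitive on $\mathcal{V}$, then $\gamma$ is a union of $N$-orbits.
   Context: $\binom{\mathcal{V}}{k}$ is the set of $k$-subsets of $\mathcal{V}$; for $\Gamma\subseteq\binom{\mathcal{V}}{k}$, $\delta(\Gamma)$ is the minimum of $k-|\gamma_1\cap\gamma_2|$ over distinct $\gamma_1,\gamma_2\in\Gamma$. For $G\le\mathrm{Sym}(\mathcal{V})$ leaving $\Gamma$ invariant, $\Gamma$ is $G$-strongly incidence transitive if $G$ is transitive on $\Gamma$ and, for $\gamma\in\Gamma$, the setwise stabiliser $G_\gamma$ is transitive on the set of pairs $(u,u')$ with $u\in\gamma$, $u'\in\mathcal{V}\setminus\gamma$. -}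

module Defs where

open import Data.Nat using (ℕ; _∸_; _≤_; _+_)
open import Data.Fin using (Fin)
open import Data.Fin.Subset using (Subset; _∈_; _∉_; ∣_∣; _∩_)
open import Data.Fin.Permutation using (Permutation′; _⟨$⟩ʳ_; _⟨$⟩ˡ_; id; flip; _∘ₚ_)
open import Data.Vec using (tabulate; lookup)
open import Data.Product using (Σ; _×_; ∃)
open import Data.Sum using (_⊎_)
open import Relation.Binary.PropositionalEquality using (_≡_; _≢_)
open import Relation.Nullary using (¬_)

PermSet : ℕ → Set₁
PermSet v = Permutation′ v → Set

record IsPermGroup {v : ℕ} (G : PermSet v) : Set where
  field
    respects : ∀ σ τ → (∀ i → σ ⟨$⟩ʳ i ≡ τ ⟨$⟩ʳ i) → G σ → G τ
    id-mem   : G id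
    ∘-mem    : ∀ σ τ → G σ → G τ → G (σ ∘ₚ τ)
    inv-mem  : ∀ σ → G σ → G (flip σ)

_⊆ₚ_ : {v : ℕ} → PermSet v → PermSet v → Set
H ⊆ₚ G = ∀ σ → H σ → G σ

IsSubgroup : {v : ℕ} → PermSet v → PermSet v → Set
IsSubgroup H G = IsPermGroup H × (H ⊆ₚ G)

IsMaximalSubgroup : {v : ℕ} → PermSet v → PermSet v → Set₁
IsMaximalSubgroup {v} H G =
  IsSubgroup H G ×
  (Σ (Permutation′ v) (λ σ → G σ × ¬ H σ)) ×
  (∀ (K : PermSet v) → IsSubgroup K G → H ⊆ₚ K → (K ⊆ₚ H) ⊎ (G ⊆ₚ K))

IsNormalSubgroup : {v : ℕ} → PermSet v → PermSet v → Set
IsNormalSubgroup N H =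
  IsSubgroup N H × (∀ h n → H h → N n → N ((flip h ∘ₚ n) ∘ₚ h))

IsTransitive : {v : ℕ} → PermSet v → Set
IsTransitive {v} G = ∀ (i j : Fin v) → Σ (Permutation′ v) (λ σ → G σ × σ ⟨$⟩ʳ i ≡ j)

-- image of a subset under a permutation: σ(γ) = { σ x | x ∈ γ }
image : {v : ℕ} → Permutation′ v → Subset v → Subset v
image σ γ = tabulate (λ i → lookup γ (σ ⟨$⟩ˡ i))

Family : ℕ → Set₁
Family v = Subset v → Set

IsKSubsetFamily : {v : ℕ} → ℕ → Family v → Set
IsKSubsetFamily k Γ = ∀ γ → Γ γ → ∣ γ ∣ ≡ k

MinDistanceAtLeast : {v : ℕ} → ℕ → Family v → ℕ → Set
MinDistanceAtLeast k Γ d = ∀ γ₁ γ₂ → Γ γ₁ → Γ γ₂ → γ₁ ≢ γ₂ → d ≤ k ∸ ∣ γ₁ ∩ γ₂ ∣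

Leaves : {v : ℕ} → PermSet v → Family v → Set
Leaves G Γ = ∀ σ γ → G σ → Γ γ → Γ (image σ γ)

Stab : {v : ℕ} → PermSet v → Subset v → PermSet v
Stab G γ σ = G σ × image σ γ ≡ γ

IsStronglyIncidenceTransitive : {v : ℕ} → PermSet v → Family v → Set
IsStronglyIncidenceTransitive {v} G Γ =
  Leaves G Γ ×
  (∀ γ₁ γ₂ → Γ γ₁ → Γ γ₂ → Σ (Permutation′ v) (λ σ → G σ × image σ γ₁ ≡ γ₂)) ×
  (∀ γ → Γ γ → ∀ (u u' w w' : Fin v) → u ∈ γ → u' ∉ γ → w ∈ γ → w' ∉ γ →
     Σ (Permutation′ v) (λ σ → Stab G γ σ × σ ⟨$⟩ʳ u ≡ w × σ ⟨$⟩ʳ u' ≡ w'))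

IsUnionOfOrbits : {v : ℕ} → PermSet v → Subset v → Set
IsUnionOfOrbits N γ = ∀ σ i → N σ → i ∈ γ → σ ⟨$⟩ʳ i ∈ γ

{-# OPTIONS --safe #-}
-- If some n ∈ N maps a point of γ outside γ, conjugating n by elements of
-- G_γ ≤ H (which normalise N) and using that G_γ is transitive on pairs
-- (inside γ, outside γ) shows that every point of γ shares an N-orbit with
-- every point outside γ; as N-orbits partition V, N would be transitive.
module Submission where

open import Defs
open import Data.Nat using (ℕ; _≤_; _/_)
open import Data.Fin using (Fin)
open import Data.Fin.Subset using (Subset; _∈_; _∉_)
open import Data.Fin.Subset.Properties using (_∈?_)
open import Data.Fin.Permutation using (Permutation′; _⟨$⟩ʳ_; _⟨$⟩ˡ_; flip; _∘ₚ_; inverseˡ)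
open import Data.Product using (Σ; _×_; _,_)
open import Relation.Nullary using (¬_; yes; no)
open import Relation.Binary.PropositionalEquality using (_≡_; refl; sym; trans; cong; module ≡-Reasoning)
open import Data.Empty using (⊥-elim)

SameOrbit : {v : ℕ} → PermSet v → Fin v → Fin v → Set
SameOrbit {v} N x y = Σ (Permutation′ v) (λ σ → N σ × σ ⟨$⟩ʳ x ≡ y)

IsFlagTransitiveOn : {v : ℕ} → PermSet v → Subset v → Set
IsFlagTransitiveOn {v} G γ = ∀ (u u' w w' : Fin v) → u ∈ γ → u' ∉ γ → w ∈ γ → w' ∉ γ →
  Σ (Permutation′ v) (λ σ → Stab G γ σ × σ ⟨$⟩ʳ u ≡ w × σ ⟨$⟩ʳ u' ≡ w')

module _ {v : ℕ} {N : PermSet v} (N-group : IsPermGroup N) where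
  open IsPermGroup N-group

  SameOrbit-sym : ∀ {x y} → SameOrbit N x y → SameOrbit N y x
  SameOrbit-sym {x} {y} (σ , Nσ , σx≡y) = flip σ , inv-mem σ Nσ , (begin
    σ ⟨$⟩ˡ y              ≡⟨ cong (σ ⟨$⟩ˡ_) (sym σx≡y) ⟩
    σ ⟨$⟩ˡ (σ ⟨$⟩ʳ x)     ≡⟨ inverseˡ σ ⟩
    x                     ∎)
    where open ≡-Reasoning

  SameOrbit-trans : ∀ {x y z} → SameOrbit N x y → SameOrbit N y z → SameOrbit N x z
  SameOrbit-trans (σ , Nσ , σx≡y) (τ , Nτ , τy≡z) =
    σ ∘ₚ τ , ∘-mem σ τ Nσ Nτ , trans (cong (τ ⟨$⟩ʳ_) σx≡y) τy≡z

SameOrbit-normal-invariant : {v : ℕ} {N H : PermSet v} → IsNormalSubgroup N H →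
  ∀ {x y} h → H h → SameOrbit N x y → SameOrbit N (h ⟨$⟩ʳ x) (h ⟨$⟩ʳ y)
SameOrbit-normal-invariant (_ , normal) {x} {y} h Hh (σ , Nσ , σx≡y) =
  (flip h ∘ₚ σ) ∘ₚ h , normal h σ Hh Nσ , (begin
    h ⟨$⟩ʳ (σ ⟨$⟩ʳ (h ⟨$⟩ˡ (h ⟨$⟩ʳ x)))  ≡⟨ cong (λ z → h ⟨$⟩ʳ (σ ⟨$⟩ʳ z)) (inverseˡ h) ⟩
    h ⟨$⟩ʳ (σ ⟨$⟩ʳ x)                    ≡⟨ cong (h ⟨$⟩ʳ_) σx≡y ⟩
    h ⟨$⟩ʳ y                             ∎)
  where open ≡-Reasoning

SameOrbit-across : {v : ℕ} {G H N : PermSet v} {γ : Subset v} →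
  IsFlagTransitiveOn G γ → Stab G γ ⊆ₚ H → IsNormalSubgroup N H →
  ∀ {u u'} → u ∈ γ → u' ∉ γ → SameOrbit N u u' →
  ∀ w w' → w ∈ γ → w' ∉ γ → SameOrbit N w w'
SameOrbit-across flag stab⊆H N⊴H u∈γ u'∉γ uu' w w' w∈γ w'∉γ
  with flag _ _ w w' u∈γ u'∉γ w∈γ w'∉γ
... | h , stab , refl , refl = SameOrbit-normal-invariant N⊴H h (stab⊆H h stab) uu'

transitive-if-across : {v : ℕ} {N : PermSet v} → IsPermGroup N → (γ : Subset v) →
  ∀ {u u'} → u ∈ γ → u' ∉ γ →
  (∀ w w' → w ∈ γ → w' ∉ γ → SameOrbit N w w') → IsTransitive N
transitive-if-across N-group γ {u} {u'} u∈γ u'∉γ across x y with x ∈? γ | y ∈? γ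
... | yes x∈γ | yes y∈γ = SameOrbit-trans N-group (across x u' x∈γ u'∉γ)
                            (SameOrbit-sym N-group (across y u' y∈γ u'∉γ))
... | yes x∈γ | no  y∉γ = across x y x∈γ y∉γ
... | no  x∉γ | yes y∈γ = SameOrbit-sym N-group (across y x y∈γ x∉γ)
... | no  x∉γ | no  y∉γ = SameOrbit-trans N-group (SameOrbit-sym N-group (across u x u∈γ x∉γ))
                            (across u y u∈γ y∉γ)

lemma2p1 : (v : ℕ) (G : PermSet v) → IsPermGroup G →
           (k : ℕ) → 2 ≤ k → k ≤ v / 2 →
           (Γ : Family v) → IsKSubsetFamily k Γ → MinDistanceAtLeast k Γ 2 →
           IsStronglyIncidenceTransitive G Γ →
           (γ : Subset v) → Γ γ →
           (H : PermSet v) → IsMaximalSubgroup H G → Stab G γ ⊆ₚ H →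
           IsTransitive H →
           (N : PermSet v) → IsNormalSubgroup N H → ¬ IsTransitive N →
           IsUnionOfOrbits N γ
lemma2p1 v G _ k _ _ Γ _ _ (_ , _ , flag) γ γ∈Γ H _ stab⊆H _ N N⊴H@((N-group , _) , _) intransitive
         n i Nn i∈γ
  with n ⟨$⟩ʳ i ∈? γ
... | yes ni∈γ = ni∈γ
... | no  ni∉γ = ⊥-elim (intransitive (transitive-if-across N-group γ i∈γ ni∉γ
                   (SameOrbit-across (flag γ γ∈Γ) stab⊆H N⊴H i∈γ ni∉γ (n , Nn , refl))))
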